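{- Let $x<y$ be positive integers with $y\ge 5$. Then \[ \frac{x(y-x)+1}{y}< \frac{x(y+1-x)}{y+1}\quad\text{or}\quad \frac{x(y-x)+1}{y}< \frac{(x+1)(y-x)}{y+1}.\] -}

-- Put d = y − x. Cross-multiplying, the two inequalities become
-- x d y + x d + (y + 1) < x d y + x d + x² and the same with d² on the right,
-- i.e. y + 1 < x² or y + 1 < d². Since x + d = y ≥ 5, the larger of x and d
-- is at least 3, so its square is at least three times itself, which exceeds y + 1.
module Submission where

open import Data.Nat hiding (_/_)
open import Data.Nat.Properties
open import Data.Nat.Tactic.RingSolver using (solve-∀)
open import Data.Integer using (+_; +<+)
import Data.Integer as ℤ
open import Data.Integer.Properties using (pos-*)
open import Data.Rational using (_/_) renaming (_<_ to _<ℚ_)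
open import Data.Rational.Properties using (toℚᵘ-cancel-<; toℚᵘ-fromℚᵘ)
import Data.Rational.Unnormalised as ℚᵘ
import Data.Rational.Unnormalised.Properties as ℚᵘ
open import Data.Sum using (_⊎_; inj₁; inj₂; [_,_]′; map)
open import Relation.Binary.PropositionalEquality

*<*⇒/< : ∀ i j m n → i ℤ.* + suc n ℤ.< j ℤ.* + suc m → i / suc m <ℚ j / suc n
*<*⇒/< i j m n cross = toℚᵘ-cancel-<
  (ℚᵘ.<-respˡ-≃ (ℚᵘ.≃-sym (toℚᵘ-fromℚᵘ (ℚᵘ.mkℚᵘ i m)))
  (ℚᵘ.<-respʳ-≃ (ℚᵘ.≃-sym (toℚᵘ-fromℚᵘ (ℚᵘ.mkℚᵘ j n)))
  (ℚᵘ.*<* cross)))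

ℕ-*<*⇒/< : ∀ a c m n → a * suc n < c * suc m → + a / suc m <ℚ + c / suc n
ℕ-*<*⇒/< a c m n cross =
  *<*⇒/< (+ a) (+ c) m n (subst₂ ℤ._<_ (pos-* a (suc n)) (pos-* c (suc m)) (+<+ cross))

5≤m+m⇒3≤m : ∀ m → 5 ≤ m + m → 3 ≤ m
5≤m+m⇒3≤m 0 ()
5≤m+m⇒3≤m 1 (s≤s (s≤s ()))
5≤m+m⇒3≤m 2 (s≤s (s≤s (s≤s (s≤s ()))))
5≤m+m⇒3≤m (suc (suc (suc m))) _ = s≤s (s≤s (s≤s z≤n))

1+m+n<m*m : ∀ {m n} → n ≤ m → 5 ≤ m + n → suc (m + n) < m * m
1+m+n<m*m {m} {n} n≤m 5≤m+n = begin-strict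
  suc (m + n)     ≤⟨ s≤s (+-monoʳ-≤ m n≤m) ⟩
  suc (m + m)     <⟨ n<1+n (suc (m + m)) ⟩
  2 + (m + m)     ≤⟨ +-monoˡ-≤ (m + m) (≤-trans (s≤s (s≤s z≤n)) 3≤m) ⟩
  m + (m + m)     ≡⟨ cong (λ k → m + (m + k)) (sym (+-identityʳ m)) ⟩
  3 * m           ≤⟨ *-monoˡ-≤ m 3≤m ⟩
  m * m           ∎
  where
  open ≤-Reasoning
  3≤m : 3 ≤ m
  3≤m = 5≤m+m⇒3≤m m (≤-trans 5≤m+n (+-monoʳ-≤ m n≤m))

cross-multiplied : ∀ x d → 5 ≤ x + d →
  (x * d + 1) * suc (x + d) < x * suc d * (x + d) ⊎
  (x * d + 1) * suc (x + d) < (x + 1) * d * (x + d)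
cross-multiplied x d 5≤x+d = [ (λ d≤x → inj₁ (lhs<rhs (rhs₁-expand x d) (1+m+n<m*m d≤x 5≤x+d)))
                             , (λ x≤d → inj₂ (lhs<rhs (rhs₂-expand x d) (1+x+d<d*d x≤d)))
                             ]′ (≤-total d x)
  where
  common : ℕ
  common = x * d * (x + d) + x * d
  lhs-expand : ∀ a b → (a * b + 1) * suc (a + b) ≡ a * b * (a + b) + a * b + suc (a + b)
  lhs-expand = solve-∀
  rhs₁-expand : ∀ a b → a * suc b * (a + b) ≡ a * b * (a + b) + a * b + a * a
  rhs₁-expand = solve-∀
  rhs₂-expand : ∀ a b → (a + 1) * b * (a + b) ≡ a * b * (a + b) + a * b + b * b
  rhs₂-expand = solve-∀
  lhs<rhs : ∀ {r t} → r ≡ common + t → suc (x + d) < t → (x * d + 1) * suc (x + d) < r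
  lhs<rhs r≡ lt = subst₂ _<_ (sym (lhs-expand x d)) (sym r≡) (+-monoʳ-< common lt)
  1+x+d<d*d : x ≤ d → suc (x + d) < d * d
  1+x+d<d*d x≤d = subst (λ s → suc s < d * d) (+-comm d x)
                    (1+m+n<m*m x≤d (subst (5 ≤_) (+-comm x d) 5≤x+d))

cross-multiplied-∸ : ∀ x y → x ≤ y → 5 ≤ y →
  (x * (y ∸ x) + 1) * suc y < x * (suc y ∸ x) * y ⊎
  (x * (y ∸ x) + 1) * suc y < (x + 1) * (y ∸ x) * y
cross-multiplied-∸ x y x≤y rewrite +-∸-assoc 1 x≤y with y ∸ x | m+[n∸m]≡n x≤y
... | d | refl = cross-multiplied x d

lemma2p5 : (x y : ℕ) .{{_ : NonZero y}} → 1 ≤ x → x < y → 5 ≤ y →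
    (((+ (x * (y ∸ x) + 1)) / y) <ℚ ((+ (x * (suc y ∸ x))) / suc y))
    ⊎ (((+ (x * (y ∸ x) + 1)) / y) <ℚ ((+ ((x + 1) * (y ∸ x))) / suc y))
lemma2p5 x y@(suc y-1) _ x<y 5≤y =
  map (ℕ-*<*⇒/< numerator (x * (suc y ∸ x)) y-1 y) (ℕ-*<*⇒/< numerator ((x + 1) * (y ∸ x)) y-1 y)
      (cross-multiplied-∸ x y (<⇒≤ x<y) 5≤y)
  where
  numerator : ℕ
  numerator = x * (y ∸ x) + 1
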